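{- For every positive integer $m$, the cyclotomic polytope $\mathcal{C}_m\subset\mathbb{R}^{\phi(m)}$ equals, up to a permutation of the coordinates, the $(m/\sqrt m)$-fold direct sum $\mathcal{C}_{\sqrt m}^{\circ (m/\sqrt m)}$, where $\sqrt m$ is the product of the distinct primes dividing $m$.
   Context: Cyclotomic polytopes are defined as follows. For $p$ prime, $\mathcal{C}_p=\operatorname{conv}(e_1,\dots,e_{p-1},-\sum_i e_i)\subset\mathbb{R}^{p-1}$. For $p$ prime and $\alpha\ge2$, with $\zeta=e^{2\pi i/p^\alpha}$, identify the $\mathbb{Z}$-basis element $\zeta^{k+jp^{\alpha-1}}$ ($0\le k\le p^{\alpha-1}-1$, $0\le j\le p-2$) of $\mathbb{Z}[\zeta]$ with the unit vector $e_{k(p-1)+j}\in\mathbb{R}^{\phi(p^\alpha)}$, and let $\mathcal{C}_{p^\alpha}$ be the convex hull of the points representing all $p^\alpha$ powers of $\zeta$. For $m=m_1m_2$ with $m_1,m_2>1$ coprime, use products of the chosen bases of $\mathbb{Z}[\zeta_{m_1}]$ and $\mathbb{Z}[\zeta_{m_2}]$ as a basis of $\mathbb{Z}[\zeta_m]$, identify $\mathbb{R}^{\phi(m)}=\mathbb{R}^{\phi(m_1)}\otimes\mathbb{R}^{\phi(m_2)}$ (Kronecker product coordinates), and set $\mathcal{C}_m=\mathcal{C}_{m_1}\otimes\mathcal{C}_{m_2}$, where for polytopes $P,Q$ with vertices $v_i$, $w_j$ the tensor product is $P\otimes Q=\operatorname{conv}(v_i\otimes w_j)$. Thus for $m=\prod_i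 p_i^{\alpha_i}$, $\mathcal{C}_m=\bigotimes_i\mathcal{C}_{p_i^{\alpha_i}}$, the convex hull of the points representing the $m$-th roots of unity. The direct sum of polytopes $P\subset\mathbb{R}^{d_1}$, $Q\subset\mathbb{R}^{d_2}$ containing the origin in their interiors is $P\circ Q=\operatorname{conv}(P\times\{0\}\cup\{0\}\times Q)$, and $P^{\circ k}$ is the $k$-fold direct sum.
   Formalization: The two polytopes are compared only at points with rational coordinates, written as convex combinations of the vertices with rational weights, rather than in $\mathbb{R}^{\phi(m)}$. -}

module Defs where

open import Data.Nat as ℕ using (ℕ; zero; suc; _∸_; _^_; _<ᵇ_; _≡ᵇ_)
open import Data.Nat.Primality using (Prime)
open import Data.Fin as Fin using (Fin; toℕ; remQuot)
open import Data.Rational as ℚ using (ℚ; 0ℚ; 1ℚ; _+_; _*_; -_; _≤_)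
open import Data.List as List using (List; []; _∷_; map; foldr; upTo; allFin; length; zipWith; concatMap; cartesianProductWith)
open import Data.Nat.ListAction using (product)
open import Data.List.Relation.Unary.All using (All)
open import Data.List.Relation.Unary.Linked using (Linked)
open import Data.Product using (Σ; ∃; _×_; _,_; proj₁; proj₂)
open import Data.Bool using (Bool; if_then_else_; _∧_)
open import Function using (_∘_)
open import Function.Bundles using (_↔_; _⇔_; Inverse)
open import Relation.Binary.PropositionalEquality using (_≡_)

Point : ℕ → Set
Point d = Fin d → ℚ

record VPolytope : Set where
  constructor vpoly
  field
    dim   : ℕ
    verts : List (Point dim)
open VPolytope public

sumℚ : List ℚ → ℚ
sumℚ = foldr _+_ 0ℚ

InConv : ∀ {d} → List (Point d) → Point d → Set
InConv vs x =
  Σ (List ℚ) λ ls →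
    (length ls ≡ length vs) × All (0ℚ ≤_) ls × (sumℚ ls ≡ 1ℚ) ×
    (∀ c → x c ≡ sumℚ (zipWith (λ l v → l * v c) ls vs))

_∈conv_ : ∀ {d} → Point d → List (Point d) → Set
x ∈conv vs = InConv vs x

_≅ₚ_ : VPolytope → VPolytope → Set
P ≅ₚ Q = Σ (Fin (dim P) ↔ Fin (dim Q)) λ σ →
  ∀ (x : Point (dim Q)) → (x ∈conv verts Q) ⇔ ((x ∘ Inverse.to σ) ∈conv verts P)

-- Tensor product (Kronecker coordinates: index i * b + j ↦ (i , j))

_⊗ᵥ_ : ∀ {a b} → Point a → Point b → Point (a ℕ.* b)
_⊗ᵥ_ {a} {b} v w x = let ij = remQuot {a} b x in v (proj₁ ij) * w (proj₂ ij)

_⊗_ : VPolytope → VPolytope → VPolytope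
P ⊗ Q = vpoly (dim P ℕ.* dim Q) (cartesianProductWith _⊗ᵥ_ (verts P) (verts Q))

-- Direct sum P^{∘k}: convex hull of the copies of P in each of the k blocks
-- (block t occupies coordinates t * d , … , t * d + d - 1).

embed : ∀ {d} k → Fin k → Point d → Point (k ℕ.* d)
embed {d} k t v x = let ti = remQuot {k} d x in
  if toℕ (proj₁ ti) ≡ᵇ toℕ t then v (proj₂ ti) else 0ℚ

directSumPow : VPolytope → ℕ → VPolytope
directSumPow P k =
  vpoly (k ℕ.* dim P) (concatMap (λ t → map (embed k t) (verts P)) (allFin k))

-- Cyclotomic polytope of a prime power p^α (α ≥ 1).
-- Dimension φ(p^α) = (p-1) p^(α-1); the basis element ζ^(k + j p^(α-1))
-- (0 ≤ k < p^(α-1), 0 ≤ j ≤ p-2) is e_{k(p-1)+j}.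

φpp : ℕ → ℕ → ℕ
φpp p α = (p ∸ 1) ℕ.* p ^ (α ∸ 1)

-- The point representing ζ^(k + j p^(α-1)), for 0 ≤ k < p^(α-1), 0 ≤ j ≤ p-1.
-- For j ≤ p-2 it is the basis vector e_{k(p-1)+j}; for j = p-1 it is
-- ζ^(k+(p-1)p^(α-1)) = - Σ_{j'=0}^{p-2} ζ^(k + j' p^(α-1)).
rootPoint : (p α k j : ℕ) → Point (φpp p α)
rootPoint p α k j c =
  if j <ᵇ (p ∸ 1)
  then (if toℕ c ≡ᵇ (k ℕ.* (p ∸ 1) ℕ.+ j) then 1ℚ else 0ℚ)
  else (if (k ℕ.* (p ∸ 1) ℕ.≤ᵇ toℕ c) ∧ (toℕ c <ᵇ k ℕ.* (p ∸ 1) ℕ.+ (p ∸ 1))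
        then - 1ℚ else 0ℚ)

-- All p^α powers ζ^n, n = k + j p^(α-1).
cycPP : ℕ → ℕ → VPolytope
cycPP p α = vpoly (φpp p α)
  (concatMap (λ k → map (rootPoint p α k) (upTo p)) (upTo (p ^ (α ∸ 1))))

value : List (ℕ × ℕ) → ℕ
value fs = product (map (λ pa → proj₁ pa ^ proj₂ pa) fs)

IsPrimeFactorization : ℕ → List (ℕ × ℕ) → Set
IsPrimeFactorization m fs =
  All (λ pa → Prime (proj₁ pa) × 1 ℕ.≤ proj₂ pa) fs ×
  Linked ℕ._<_ (map proj₁ fs) ×
  (m ≡ value fs)

-- radical factorization: √m = ∏ p_i, factorization (p_i , 1)
radFactors : List (ℕ × ℕ) → List (ℕ × ℕ)
radFactors = map (λ pa → proj₁ pa , 1)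

-- C_m = ⊗_i C_{p_i^{α_i}}; the empty product (m = 1) is conv{1} ⊂ ℚ^1.
cyc : List (ℕ × ℕ) → VPolytope
cyc []             = vpoly 1 ((λ _ → 1ℚ) ∷ [])
cyc ((p , α) ∷ fs) = cycPP p α ⊗ cyc fs

-- Both sides are convex hulls of explicit vertex lists, so it suffices to give a coordinate
-- permutation under which the two vertex lists agree up to repetition: a convex combination
-- over one list is moved onto the matching points of the other.  For a prime power, the vertex ζ^(k + j p^(α-1)) of C_{p^α} is supported on the k-th
-- block of p - 1 coordinates, where it is the vertex ζ^j of C_p; so C_{p^α} ≅ C_p^{∘ p^(α-1)}.
-- Writing the copy of v in block t as e_t ⊗ v, the interchange of tensor factors
-- (e_s ⊗ v) ⊗ (e_t ⊗ w) ↦ (e_s ⊗ e_t) ⊗ (v ⊗ w) = e_(s,t) ⊗ (v ⊗ w) gives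
-- P^{∘a} ⊗ Q^{∘b} ≅ (P ⊗ Q)^{∘ab}.  Induction over the factorization yields
-- C_m ≅ C_{√m}^{∘K} with K = ∏ p_i^(α_i - 1) for any list of pairs (p_i, α_i); the
-- hypotheses of the theorem only serve to identify k with K.
module Submission where

open import Defs
open import Algebra.Bundles using (CommutativeMonoid)
open import Data.Bool using (Bool; true; false; T; if_then_else_; _∧_)
open import Data.Bool.Properties using (T-≡; T-∧; ⇔→≡)
open import Data.Fin using (Fin; toℕ; combine; remQuot)
open import Data.List using (List; []; _∷_; map; zipWith; length; cartesianProductWith; allFin)
open import Data.List.Membership.Propositional using (_∈_; lose)
open import Data.List.Membership.Propositional.Properties
  using (∈-map⁺; ∈-map⁻; ∈-concatMap⁺; ∈-concatMap⁻; ∈-allFin;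
         ∈-cartesianProductWith⁺; ∈-cartesianProductWith⁻)
open import Data.List.Relation.Unary.Any using (here; there; satisfied)
open import Data.Nat as ℕ using (ℕ; suc)
open import Data.Product using (∃-syntax; _×_; _,_; proj₁; proj₂; uncurry) renaming (map to map×)
open import Function using (_∘_)
open import Function.Bundles using (_↔_; Inverse; _⇔_; mk⇔; mk↔ₛ′; module Equivalence)
open import Function.Properties.Inverse using (↔-refl; ↔-trans; ↔-sym)
open import Relation.Binary.PropositionalEquality

open Inverse using (to; from; strictlyInverseˡ)
module ⇔ = Equivalence

private variable
  a a' b b' c : ℕ
  A : Set

T-injective : {x y : Bool} → (T x → T y) → (T y → T x) → x ≡ y
T-injective x⇒y y⇒x = ⇔→≡ (mk⇔ (⇔.to T-≡ ∘ x⇒y ∘ ⇔.from T-≡) (⇔.to T-≡ ∘ y⇒x ∘ ⇔.from T-≡))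

module ConvexHull where
  open import Data.List.Properties using (length-map)
  open import Data.List.Relation.Unary.All using (All; []; _∷_; universal)
  open import Data.List.Relation.Unary.All.Properties using (map⁺)
  open import Data.Nat.Properties using (suc-injective)
  open import Data.Rational using (ℚ; 0ℚ; _+_; _*_; _≤_)
  open import Data.Rational.Properties
    using (+-identityˡ; *-zeroˡ; *-distribʳ-+; +-assoc; ≤-refl; +-mono-≤; +-0-commutativeMonoid)
  open import Algebra.Properties.CommutativeSemigroup
    (CommutativeMonoid.commutativeSemigroup +-0-commutativeMonoid) using (x∙yz≈y∙xz)

  comb : List ℚ → List (Point a) → Point a
  comb ls vs x = sumℚ (zipWith (λ l v → l * v x) ls vs)

  _⊆[_]_ : List (Point b) → (Fin a → Fin b) → List (Point a) → Set
  ws ⊆[ τ ] vs = ∀ {w} → w ∈ ws → ∃[ v ] v ∈ vs × v ≗ w ∘ τ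

  _⊇[_]_ : List (Point b) → (Fin a → Fin b) → List (Point a) → Set
  ws ⊇[ τ ] vs = ∀ {v} → v ∈ vs → ∃[ w ] w ∈ ws × v ≗ w ∘ τ

  Nonneg : List ℚ → Set
  Nonneg = All (0ℚ ≤_)

  zeros : List A → List ℚ
  zeros = map (λ _ → 0ℚ)

  zeros-nonneg : (xs : List A) → Nonneg (zeros xs)
  zeros-nonneg xs = map⁺ (universal (λ _ → ≤-refl) xs)

  sum-zeros : (xs : List A) → sumℚ (zeros xs) ≡ 0ℚ
  sum-zeros []       = refl
  sum-zeros (_ ∷ xs) = trans (+-identityˡ _) (sum-zeros xs)

  comb-zeros : (vs : List (Point a)) (x : Fin a) → comb (zeros vs) vs x ≡ 0ℚ
  comb-zeros []       x = refl
  comb-zeros (v ∷ vs) x = trans (cong₂ _+_ (*-zeroˡ (v x)) (comb-zeros vs x)) (+-identityˡ 0ℚ)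

  bump : {y : A} {xs : List A} → y ∈ xs → ℚ → List ℚ → List ℚ
  bump _         _ []       = []
  bump (here _)  l (k ∷ ks) = l + k ∷ ks
  bump (there p) l (k ∷ ks) = k ∷ bump p l ks

  length-bump : {y : A} {xs : List A} (p : y ∈ xs) (l : ℚ) (ks : List ℚ) →
                length (bump p l ks) ≡ length ks
  length-bump _         l []       = refl
  length-bump (here _)  l (k ∷ ks) = refl
  length-bump (there p) l (k ∷ ks) = cong suc (length-bump p l ks)

  bump-nonneg : {y : A} {xs : List A} (p : y ∈ xs) {l : ℚ} {ks : List ℚ} →
                0ℚ ≤ l → Nonneg ks → Nonneg (bump p l ks)
  bump-nonneg _                    0≤l []           = []
  bump-nonneg (here _) {l} {k ∷ _} 0≤l (0≤k ∷ 0≤ks) =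
    subst (_≤ l + k) (+-identityˡ 0ℚ) (+-mono-≤ 0≤l 0≤k) ∷ 0≤ks
  bump-nonneg (there p)            0≤l (0≤k ∷ 0≤ks) = 0≤k ∷ bump-nonneg p 0≤l 0≤ks

  sum-bump : {y : A} {xs : List A} (p : y ∈ xs) (l : ℚ) (ks : List ℚ) →
             length ks ≡ length xs → sumℚ (bump p l ks) ≡ l + sumℚ ks
  sum-bump (here _)  l (k ∷ ks) _ = +-assoc l k (sumℚ ks)
  sum-bump (there p) l (k ∷ ks) e =
    trans (cong (k +_) (sum-bump p l ks (suc-injective e))) (x∙yz≈y∙xz k l _)

  comb-bump : {v : Point a} {vs : List (Point a)} (p : v ∈ vs) (l : ℚ) (ks : List ℚ) →
              length ks ≡ length vs → ∀ x → comb (bump p l ks) vs x ≡ l * v x + comb ks vs x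
  comb-bump {v = v} (here refl) l (k ∷ ks) _ x =
    trans (cong (_+ _) (*-distribʳ-+ (v x) l k)) (+-assoc (l * v x) (k * v x) _)
  comb-bump {vs = w ∷ _} (there p) l (k ∷ ks) e x =
    trans (cong (k * w x +_) (comb-bump p l ks (suc-injective e) x))
          (x∙yz≈y∙xz (k * w x) (l * _) (comb ks _ x))

  module _ {vs : List (Point a)} {τ : Fin a → Fin b} where

    transfer : {ws : List (Point b)} → ws ⊆[ τ ] vs → List ℚ → List ℚ
    transfer {[]}    _   _        = zeros vs
    transfer {_ ∷ _} _   []       = zeros vs
    transfer {_ ∷ _} sub (l ∷ ls) =
      bump (proj₁ (proj₂ (sub (here refl)))) l (transfer (sub ∘ there) ls)

    length-transfer : {ws : List (Point b)} (sub : ws ⊆[ τ ] vs) (ls : List ℚ) →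
                      length (transfer sub ls) ≡ length vs
    length-transfer {[]}    _   _        = length-map _ vs
    length-transfer {_ ∷ _} _   []       = length-map _ vs
    length-transfer {_ ∷ _} sub (l ∷ ls) =
      trans (length-bump _ l (transfer (sub ∘ there) ls)) (length-transfer (sub ∘ there) ls)

    transfer-nonneg : {ws : List (Point b)} (sub : ws ⊆[ τ ] vs) {ls : List ℚ} →
                      Nonneg ls → Nonneg (transfer sub ls)
    transfer-nonneg {[]}    _   _            = zeros-nonneg vs
    transfer-nonneg {_ ∷ _} _   []           = zeros-nonneg vs
    transfer-nonneg {_ ∷ _} sub (0≤l ∷ 0≤ls) =
      bump-nonneg (proj₁ (proj₂ (sub (here refl)))) 0≤l (transfer-nonneg (sub ∘ there) 0≤ls)

    sum-transfer : {ws : List (Point b)} (sub : ws ⊆[ τ ] vs) (ls : List ℚ) →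
                   length ls ≡ length ws → sumℚ (transfer sub ls) ≡ sumℚ ls
    sum-transfer {[]}    _   []       _ = sum-zeros vs
    sum-transfer {_ ∷ _} sub (l ∷ ls) e =
      trans (sum-bump v∈ l (transfer (sub ∘ there) ls) (length-transfer (sub ∘ there) ls))
            (cong (l +_) (sum-transfer (sub ∘ there) ls (suc-injective e)))
      where v∈ = proj₁ (proj₂ (sub (here refl)))

    comb-transfer : {ws : List (Point b)} (sub : ws ⊆[ τ ] vs) (ls : List ℚ) →
                    length ls ≡ length ws → ∀ x → comb (transfer sub ls) vs x ≡ comb ls ws (τ x)
    comb-transfer {[]}    _   []       _ x = comb-zeros vs x
    comb-transfer {_ ∷ _} sub (l ∷ ls) e x =
      trans (comb-bump v∈ l (transfer (sub ∘ there) ls) (length-transfer (sub ∘ there) ls) x)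
            (cong₂ _+_ (cong (l *_) (v≗ x)) (comb-transfer (sub ∘ there) ls (suc-injective e) x))
      where
      v∈ = proj₁ (proj₂ (sub (here refl)))
      v≗ = proj₂ (proj₂ (sub (here refl)))

  conv-reindex : {ws : List (Point b)} {vs : List (Point a)} {τ : Fin a → Fin b} →
                 ws ⊆[ τ ] vs → ∀ {y} → y ∈conv ws → (y ∘ τ) ∈conv vs
  conv-reindex {τ = τ} sub (ls , len , 0≤ls , sum≡1 , y≡) =
    transfer sub ls , length-transfer sub ls , transfer-nonneg sub 0≤ls ,
    trans (sum-transfer sub ls len) sum≡1 ,
    λ x → trans (y≡ (τ x)) (sym (comb-transfer sub ls len x))

  conv-resp-≗ : {vs : List (Point a)} {y z : Point a} → y ≗ z → y ∈conv vs → z ∈conv vs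
  conv-resp-≗ y≗z (ls , len , 0≤ls , sum≡1 , y≡) =
    ls , len , 0≤ls , sum≡1 , λ x → trans (sym (y≗z x)) (y≡ x)

open ConvexHull using (_⊆[_]_; _⊇[_]_; conv-reindex; conv-resp-≗)

⊆-trans : {ws : List (Point c)} {vs : List (Point b)} {us : List (Point a)}
          {τ : Fin b → Fin c} {υ : Fin a → Fin b} →
          ws ⊆[ τ ] vs → vs ⊆[ υ ] us → ws ⊆[ τ ∘ υ ] us
⊆-trans ws⊆vs vs⊆us w∈ with v , v∈ , v≗ ← ws⊆vs w∈ with u , u∈ , u≗ ← vs⊆us v∈ =
  u , u∈ , λ x → trans (u≗ x) (v≗ _)

⊇-trans : {us : List (Point c)} {vs : List (Point b)} {ws : List (Point a)}
          {υ : Fin b → Fin c} {τ : Fin a → Fin b} →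
          us ⊇[ υ ] vs → vs ⊇[ τ ] ws → us ⊇[ υ ∘ τ ] ws
⊇-trans us⊇vs vs⊇ws w∈ with v , v∈ , w≗ ← vs⊇ws w∈ with u , u∈ , v≗ ← us⊇vs v∈ =
  u , u∈ , λ x → trans (w≗ x) (v≗ _)

⊇⇒⊆-inverse : {ws : List (Point b)} {vs : List (Point a)} (σ : Fin a ↔ Fin b) →
              ws ⊇[ to σ ] vs → vs ⊆[ from σ ] ws
⊇⇒⊆-inverse σ ws⊇vs v∈ with w , w∈ , v≗ ← ws⊇vs v∈ =
  w , w∈ , λ y → trans (cong w (sym (strictlyInverseˡ σ y))) (sym (v≗ (from σ y)))

record _≅ᵥ_ (P Q : VPolytope) : Set where
  field
    σ       : Fin (dim P) ↔ Fin (dim Q)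
    verts-⊆ : verts Q ⊆[ to σ ] verts P
    verts-⊇ : verts Q ⊇[ to σ ] verts P
open _≅ᵥ_

≅ᵥ-trans : {P Q R : VPolytope} → P ≅ᵥ Q → Q ≅ᵥ R → P ≅ᵥ R
≅ᵥ-trans P≅Q Q≅R = record
  { σ       = ↔-trans (σ P≅Q) (σ Q≅R)
  ; verts-⊆ = ⊆-trans (verts-⊆ Q≅R) (verts-⊆ P≅Q)
  ; verts-⊇ = ⊇-trans (verts-⊇ Q≅R) (verts-⊇ P≅Q)
  }

≅ᵥ⇒≅ₚ : {P Q : VPolytope} → P ≅ᵥ Q → P ≅ₚ Q
≅ᵥ⇒≅ₚ P≅Q = σ P≅Q , λ y → mk⇔
  (conv-reindex (verts-⊆ P≅Q))
  (λ y∘σ∈P → conv-resp-≗ (λ x → cong y (strictlyInverseˡ (σ P≅Q) x))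
                          (conv-reindex (⊇⇒⊆-inverse (σ P≅Q) (verts-⊇ P≅Q)) y∘σ∈P))

module Tensor where
  open import Data.Fin.Properties using (*↔×; remQuot-combine)
  open import Data.Product.Function.NonDependent.Propositional using (_×-↔_)
  open import Data.Rational using (_*_)

  _⊗ᶠ_ : (Fin a → Fin a') → (Fin b → Fin b') → Fin (a ℕ.* b) → Fin (a' ℕ.* b')
  _⊗ᶠ_ {b = b} f g = uncurry combine ∘ map× f g ∘ remQuot b

  _⊗↔_ : Fin a ↔ Fin a' → Fin b ↔ Fin b' → Fin (a ℕ.* b) ↔ Fin (a' ℕ.* b')
  σ ⊗↔ τ = ↔-trans *↔× (↔-trans (σ ×-↔ τ) (↔-sym *↔×))

  ⊗ᵥ-combine : (v : Point a) (w : Point b) (i : Fin a) (j : Fin b) →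
               (v ⊗ᵥ w) (combine i j) ≡ v i * w j
  ⊗ᵥ-combine v w i j = cong (λ (i , j) → v i * w j) (remQuot-combine i j)

  ⊗ᵥ-reindex : {v : Point a} {v' : Point a'} {w : Point b} {w' : Point b'}
               {f : Fin a → Fin a'} {g : Fin b → Fin b'} →
               v ≗ v' ∘ f → w ≗ w' ∘ g → v ⊗ᵥ w ≗ (v' ⊗ᵥ w') ∘ (f ⊗ᶠ g)
  ⊗ᵥ-reindex {a} {b = b} {v' = v'} {w' = w'} {f} {g} v≗ w≗ x =
    trans (cong₂ _*_ (v≗ i) (w≗ j)) (sym (⊗ᵥ-combine v' w' (f i) (g j)))
    where
    i = proj₁ (remQuot {a} b x)
    j = proj₂ (remQuot {a} b x)

  _⊗ˡ_ : List (Point a) → List (Point b) → List (Point (a ℕ.* b))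
  _⊗ˡ_ = cartesianProductWith _⊗ᵥ_

  ⊗ˡ-⊆ : {ws : List (Point a')} {vs : List (Point a)} {ws' : List (Point b')} {vs' : List (Point b)}
         {f : Fin a → Fin a'} {g : Fin b → Fin b'} →
         ws ⊆[ f ] vs → ws' ⊆[ g ] vs' → (ws ⊗ˡ ws') ⊆[ f ⊗ᶠ g ] (vs ⊗ˡ vs')
  ⊗ˡ-⊆ {ws = ws} {ws' = ws'} ⊆₁ ⊆₂ u∈
    with w , w' , w∈ , w'∈ , refl ← ∈-cartesianProductWith⁻ _⊗ᵥ_ ws ws' u∈
    with v , v∈ , v≗ ← ⊆₁ w∈ | v' , v'∈ , v'≗ ← ⊆₂ w'∈
    = v ⊗ᵥ v' , ∈-cartesianProductWith⁺ _⊗ᵥ_ v∈ v'∈ , ⊗ᵥ-reindex {v' = w} {w' = w'} v≗ v'≗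

  ⊗ˡ-⊇ : {ws : List (Point a')} {vs : List (Point a)} {ws' : List (Point b')} {vs' : List (Point b)}
         {f : Fin a → Fin a'} {g : Fin b → Fin b'} →
         ws ⊇[ f ] vs → ws' ⊇[ g ] vs' → (ws ⊗ˡ ws') ⊇[ f ⊗ᶠ g ] (vs ⊗ˡ vs')
  ⊗ˡ-⊇ {vs = vs} {vs' = vs'} ⊇₁ ⊇₂ u∈
    with v , v' , v∈ , v'∈ , refl ← ∈-cartesianProductWith⁻ _⊗ᵥ_ vs vs' u∈
    with w , w∈ , v≗ ← ⊇₁ v∈ | w' , w'∈ , v'≗ ← ⊇₂ v'∈
    = w ⊗ᵥ w' , ∈-cartesianProductWith⁺ _⊗ᵥ_ w∈ w'∈ , ⊗ᵥ-reindex {v' = w} {w' = w'} v≗ v'≗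

  ⊗-cong : {A A' B B' : VPolytope} → A ≅ᵥ A' → B ≅ᵥ B' → (A ⊗ B) ≅ᵥ (A' ⊗ B')
  ⊗-cong A≅A' B≅B' = record
    { σ       = σ A≅A' ⊗↔ σ B≅B'
    ; verts-⊆ = ⊗ˡ-⊆ (verts-⊆ A≅A') (verts-⊆ B≅B')
    ; verts-⊇ = ⊗ˡ-⊇ (verts-⊇ A≅A') (verts-⊇ B≅B')
    }

open Tensor using (⊗ᵥ-combine; ⊗-cong)

module DirectSum where
  open import Data.Fin.Properties using (*↔×; combine-remQuot; toℕ-injective; combine-injective)
  open import Data.Nat.Properties using (≡ᵇ⇒≡; ≡⇒≡ᵇ)
  open import Data.Product.Function.NonDependent.Propositional using (_×-↔_)
  open import Data.Rational using (ℚ; 0ℚ; 1ℚ; _*_)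
  open import Data.Rational.Properties using (*-identityˡ; *-zeroˡ; *-1-commutativeMonoid)
  import Algebra.Properties.CommutativeSemigroup
    (CommutativeMonoid.commutativeSemigroup *-1-commutativeMonoid) as *-Comm

  𝟙 : Bool → ℚ
  𝟙 b = if b then 1ℚ else 0ℚ

  𝟙-∧ : (x y : Bool) → 𝟙 (x ∧ y) ≡ 𝟙 x * 𝟙 y
  𝟙-∧ true  y = sym (*-identityˡ (𝟙 y))
  𝟙-∧ false y = sym (*-zeroˡ (𝟙 y))

  if-0≡𝟙* : (b : Bool) (q : ℚ) → (if b then q else 0ℚ) ≡ 𝟙 b * q
  if-0≡𝟙* true  q = sym (*-identityˡ q)
  if-0≡𝟙* false q = sym (*-zeroˡ q)

  _≡ᶠ_ : Fin a → Fin a → Bool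
  s ≡ᶠ t = toℕ s ℕ.≡ᵇ toℕ t

  T-≡ᶠ : (s t : Fin a) → T (s ≡ᶠ t) ⇔ s ≡ t
  T-≡ᶠ _ _ = mk⇔ (toℕ-injective ∘ ≡ᵇ⇒≡ _ _) (≡⇒≡ᵇ _ _ ∘ cong toℕ)

  basis : Fin a → Point a
  basis t s = 𝟙 (s ≡ᶠ t)

  combine-≡ᶠ : (s s' : Fin a) (t t' : Fin b) →
               (combine s' t' ≡ᶠ combine s t) ≡ (s' ≡ᶠ s) ∧ (t' ≡ᶠ t)
  combine-≡ᶠ s s' t t' = T-injective
    (λ eq → let s'≡s , t'≡t = combine-injective s' t' s t (⇔.to (T-≡ᶠ _ _) eq)
            in ⇔.from T-∧ (⇔.from (T-≡ᶠ s' s) s'≡s , ⇔.from (T-≡ᶠ t' t) t'≡t))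
    (λ eqs → let s'≡s , t'≡t = ⇔.to (T-∧ {s' ≡ᶠ s}) eqs
             in ⇔.from (T-≡ᶠ _ _)
                  (cong₂ combine (⇔.to (T-≡ᶠ s' s) s'≡s) (⇔.to (T-≡ᶠ t' t) t'≡t)))

  basis⊗basis : (s : Fin a) (t : Fin b) → basis s ⊗ᵥ basis t ≗ basis (combine s t)
  basis⊗basis {a} {b} s t x = begin
    basis s s' * basis t t'               ≡⟨ 𝟙-∧ (s' ≡ᶠ s) (t' ≡ᶠ t) ⟨
    𝟙 ((s' ≡ᶠ s) ∧ (t' ≡ᶠ t))             ≡⟨ cong 𝟙 (combine-≡ᶠ s s' t t') ⟨
    basis (combine s t) (combine s' t')   ≡⟨ cong (basis (combine s t)) (combine-remQuot {a} b x) ⟩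
    basis (combine s t) x                 ∎
    where
    open ≡-Reasoning
    s' = proj₁ (remQuot {a} b x)
    t' = proj₂ (remQuot {a} b x)

  embed≗basis⊗ : (k : ℕ) (t : Fin k) (v : Point a) → embed k t v ≗ basis t ⊗ᵥ v
  embed≗basis⊗ {a} k t v x = if-0≡𝟙* (proj₁ (remQuot {k} a x) ≡ᶠ t) (v (proj₂ (remQuot {k} a x)))

  ⊗ᵥ-cong : {v v' : Point a} {w w' : Point b} → v ≗ v' → w ≗ w' → v ⊗ᵥ w ≗ v' ⊗ᵥ w'
  ⊗ᵥ-cong v≗v' w≗w' x = cong₂ _*_ (v≗v' _) (w≗w' _)

  ×-interchange : {A B C D : Set} → ((A × B) × (C × D)) ↔ ((A × C) × (B × D))
  ×-interchange = mk↔ₛ′ (λ ((a , b) , (c , d)) → (a , c) , (b , d))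
                        (λ ((a , c) , (b , d)) → (a , b) , (c , d))
                        (λ _ → refl) (λ _ → refl)

  *-interchange↔ : Fin ((a ℕ.* a') ℕ.* (b ℕ.* b')) ↔ Fin ((a ℕ.* b) ℕ.* (a' ℕ.* b'))
  *-interchange↔ {a} {a'} {b} {b'} =
    ↔-trans (*↔× {a ℕ.* a'}) (↔-trans (*↔× {a} ×-↔ *↔× {b}) (↔-trans ×-interchange
      (↔-trans (↔-sym (*↔× {a} ×-↔ *↔× {a'})) (↔-sym (*↔× {a ℕ.* b})))))

  ⊗ᵥ-interchange : (u : Point a) (v : Point a') (u' : Point b) (v' : Point b') →
                   (u ⊗ᵥ v) ⊗ᵥ (u' ⊗ᵥ v') ≗
                   ((u ⊗ᵥ u') ⊗ᵥ (v ⊗ᵥ v')) ∘ to (*-interchange↔ {a} {a'} {b} {b'})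
  ⊗ᵥ-interchange {a} {a'} {b} {b'} u v u' v' x = begin
    (u s * v i) * (u' t * v' j)
      ≡⟨ *-Comm.interchange (u s) (v i) (u' t) (v' j) ⟩
    (u s * u' t) * (v i * v' j)
      ≡⟨ cong₂ _*_ (⊗ᵥ-combine u u' s t) (⊗ᵥ-combine v v' i j) ⟨
    (u ⊗ᵥ u') (combine s t) * (v ⊗ᵥ v') (combine i j)
      ≡⟨ ⊗ᵥ-combine (u ⊗ᵥ u') (v ⊗ᵥ v') (combine s t) (combine i j) ⟨
    ((u ⊗ᵥ u') ⊗ᵥ (v ⊗ᵥ v')) (combine (combine s t) (combine i j))
      ∎
    where
    open ≡-Reasoning
    X = proj₁ (remQuot {a ℕ.* a'} (b ℕ.* b') x)
    Y = proj₂ (remQuot {a ℕ.* a'} (b ℕ.* b') x)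
    s = proj₁ (remQuot {a} a' X)
    i = proj₂ (remQuot {a} a' X)
    t = proj₁ (remQuot {b} b' Y)
    j = proj₂ (remQuot {b} b' Y)

  ∈-directSumPow⁺ : (P : VPolytope) (k : ℕ) (t : Fin k) {v : Point (dim P)} →
                    v ∈ verts P → embed k t v ∈ verts (directSumPow P k)
  ∈-directSumPow⁺ P k t v∈ =
    ∈-concatMap⁺ (λ t → map (embed k t) (verts P)) (lose (∈-allFin t) (∈-map⁺ (embed k t) v∈))

  ∈-directSumPow⁻ : (P : VPolytope) (k : ℕ) {u : Point (k ℕ.* dim P)} →
                    u ∈ verts (directSumPow P k) → ∃[ t ] ∃[ v ] v ∈ verts P × u ≡ embed k t v
  ∈-directSumPow⁻ P k u∈
    with t , u∈ₜ ← satisfied (∈-concatMap⁻ (λ t → map (embed k t) (verts P)) {xs = allFin k} u∈)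
    with v , v∈ , refl ← ∈-map⁻ (embed k t) u∈ₜ
    = t , v , v∈ , refl

  embed⊗embed : (a b : ℕ) (s : Fin a) (t : Fin b) (v : Point a') (w : Point b') →
                embed a s v ⊗ᵥ embed b t w ≗
                embed (a ℕ.* b) (combine s t) (v ⊗ᵥ w) ∘ to (*-interchange↔ {a} {a'} {b} {b'})
  embed⊗embed {a' = a'} {b' = b'} a b s t v w x = begin
    (embed a s v ⊗ᵥ embed b t w) x
      ≡⟨ ⊗ᵥ-cong (embed≗basis⊗ a s v) (embed≗basis⊗ b t w) x ⟩
    ((basis s ⊗ᵥ v) ⊗ᵥ (basis t ⊗ᵥ w)) x
      ≡⟨ ⊗ᵥ-interchange (basis s) v (basis t) w x ⟩
    ((basis s ⊗ᵥ basis t) ⊗ᵥ (v ⊗ᵥ w)) y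
      ≡⟨ ⊗ᵥ-cong {w = v ⊗ᵥ w} (basis⊗basis s t) (λ _ → refl) y ⟩
    (basis (combine s t) ⊗ᵥ (v ⊗ᵥ w)) y
      ≡⟨ embed≗basis⊗ (a ℕ.* b) (combine s t) (v ⊗ᵥ w) y ⟨
    embed (a ℕ.* b) (combine s t) (v ⊗ᵥ w) y
      ∎
    where
    open ≡-Reasoning
    y = to (*-interchange↔ {a} {a'} {b} {b'}) x

  directSumPow-⊗ : (A B : VPolytope) (a b : ℕ) →
                   (directSumPow A a ⊗ directSumPow B b) ≅ᵥ directSumPow (A ⊗ B) (a ℕ.* b)
  directSumPow-⊗ A B a b = record { σ = shuffle ; verts-⊆ = ⊆ ; verts-⊇ = ⊇ }
    where
    shuffle = *-interchange↔ {a} {dim A} {b} {dim B}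
    A^a⊗B^b  = directSumPow A a ⊗ directSumPow B b
    [A⊗B]^ab = directSumPow (A ⊗ B) (a ℕ.* b)

    ⊆ : verts [A⊗B]^ab ⊆[ to shuffle ] verts A^a⊗B^b
    ⊆ u∈ with st , vw , vw∈ , refl ← ∈-directSumPow⁻ (A ⊗ B) (a ℕ.* b) u∈
         with v , w , v∈ , w∈ , refl ← ∈-cartesianProductWith⁻ _⊗ᵥ_ (verts A) (verts B) vw∈ =
      embed a s v ⊗ᵥ embed b t w ,
      ∈-cartesianProductWith⁺ _⊗ᵥ_ (∈-directSumPow⁺ A a s v∈) (∈-directSumPow⁺ B b t w∈) ,
      λ x → trans (embed⊗embed a b s t v w x)
                  (cong (λ st → embed (a ℕ.* b) st (v ⊗ᵥ w) _) (combine-remQuot {a} b st))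
      where
      s = proj₁ (remQuot {a} b st)
      t = proj₂ (remQuot {a} b st)

    ⊇ : verts [A⊗B]^ab ⊇[ to shuffle ] verts A^a⊗B^b
    ⊇ u∈ with u , u' , u∈ , u'∈ , refl ←
                ∈-cartesianProductWith⁻ _⊗ᵥ_ (verts (directSumPow A a)) (verts (directSumPow B b)) u∈
         with s , v , v∈ , refl ← ∈-directSumPow⁻ A a u∈
         with t , w , w∈ , refl ← ∈-directSumPow⁻ B b u'∈ =
      embed (a ℕ.* b) (combine s t) (v ⊗ᵥ w) ,
      ∈-directSumPow⁺ (A ⊗ B) (a ℕ.* b) (combine s t) (∈-cartesianProductWith⁺ _⊗ᵥ_ v∈ w∈) ,
      embed⊗embed a b s t v w

open DirectSum using (𝟙; directSumPow-⊗; ∈-directSumPow⁺; ∈-directSumPow⁻)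

open import Data.List.Relation.Unary.All as All using (All; []; _∷_)
open import Data.Nat using (_+_; _*_; _∸_; _^_; _≤_; _<_; _≡ᵇ_; _≤ᵇ_; _<ᵇ_; z<s; NonZero; >-nonZero)
open import Data.Nat.Properties
  using (*-cancelʳ-<; *-cancelˡ-≡; m*n≢0⇒m≢0; m<1+n⇒m≤n; ≤-<-trans; m≤m+n; +-comm; +-monoʳ-<;
         ≤-antisym; +-cancelˡ-≡; ≡ᵇ⇒≡; ≡⇒≡ᵇ; ≤ᵇ⇒≤; ≤⇒≤ᵇ; <ᵇ⇒<; <⇒<ᵇ)
open import Data.Rational using (ℚ; 0ℚ; 1ℚ; -_)

block-unique : ∀ {d Q K R} → R < d → K * d ≤ Q * d + R → Q * d + R < K * d + d → Q ≡ K
block-unique {d} {Q} {K} {R} R<d K*d≤ <K*d+d =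
  ≤-antisym (below Q K (≤-<-trans (m≤m+n (Q * d) R) <K*d+d))
            (below K Q (≤-<-trans K*d≤ (+-monoʳ-< (Q * d) R<d)))
  where
  below : ∀ m n → m * d < n * d + d → m ≤ n
  below m n lt = m<1+n⇒m≤n (*-cancelʳ-< d m (suc n) (subst (m * d <_) (+-comm (n * d) d) lt))

≡ᵇ-block : ∀ {d} Q K {R J} → R < d → J < d →
           (Q * d + R ≡ᵇ K * d + J) ≡ (Q ≡ᵇ K) ∧ (R ≡ᵇ J)
≡ᵇ-block {d} Q K {R} {J} R<d J<d = T-injective
  (λ eq → let e   = ≡ᵇ⇒≡ _ _ eq
              Q≡K = block-unique R<d (subst (K * d ≤_) (sym e) (m≤m+n (K * d) J))
                                     (subst (_< K * d + d) (sym e) (+-monoʳ-< (K * d) J<d))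
              R≡J = +-cancelˡ-≡ (K * d) R J (subst (λ Q → Q * d + R ≡ K * d + J) Q≡K e)
          in ⇔.from T-∧ (≡⇒≡ᵇ Q K Q≡K , ≡⇒≡ᵇ R J R≡J))
  (λ eqs → let Q≡ᵇK , R≡ᵇJ = ⇔.to (T-∧ {Q ≡ᵇ K}) eqs
           in ≡⇒≡ᵇ _ _ (cong₂ (λ Q R → Q * d + R) (≡ᵇ⇒≡ Q K Q≡ᵇK) (≡ᵇ⇒≡ R J R≡ᵇJ)))

inBlockᵇ : ∀ {d} Q K {R} → R < d →
           (K * d ≤ᵇ Q * d + R) ∧ (Q * d + R <ᵇ K * d + d) ≡ (Q ≡ᵇ K)
inBlockᵇ {d} Q K {R} R<d = T-injective
  (λ bounds → let K*d≤ , <K*d+d = ⇔.to T-∧ bounds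
              in ≡⇒≡ᵇ Q K (block-unique R<d (≤ᵇ⇒≤ _ _ K*d≤) (<ᵇ⇒< _ _ <K*d+d)))
  (λ Q≡ᵇK → subst (λ Q → T ((K * d ≤ᵇ Q * d + R) ∧ (Q * d + R <ᵇ K * d + d)))
                  (sym (≡ᵇ⇒≡ Q K Q≡ᵇK))
                  (⇔.from T-∧ (≤⇒≤ᵇ (m≤m+n (K * d) R) , <⇒<ᵇ (+-monoʳ-< (K * d) R<d))))

-- rootPoint p α k j x is, by definition, rootEntry (p ∸ 1) k j (toℕ x).
rootEntry : (d k j n : ℕ) → ℚ
rootEntry d k j n =
  if j <ᵇ d then 𝟙 (n ≡ᵇ k * d + j)
  else (if (k * d ≤ᵇ n) ∧ (n <ᵇ k * d + d) then - 1ℚ else 0ℚ)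

rootEntry-block : ∀ {d} Q K {R} j → R < d →
                  rootEntry d K j (Q * d + R) ≡ (if Q ≡ᵇ K then rootEntry d 0 j R else 0ℚ)
rootEntry-block {d} Q K {R} j R<d with j <ᵇ d in j<ᵇd
... | true  rewrite ≡ᵇ-block Q K R<d (<ᵇ⇒< j d (⇔.from T-≡ j<ᵇd)) = 𝟙-∧-if (Q ≡ᵇ K) (R ≡ᵇ j)
  where
  𝟙-∧-if : (x y : Bool) → 𝟙 (x ∧ y) ≡ (if x then 𝟙 y else 0ℚ)
  𝟙-∧-if true  _ = refl
  𝟙-∧-if false _ = refl
... | false rewrite inBlockᵇ Q K R<d | ⇔.to T-≡ (<⇒<ᵇ R<d) = refl

module _ (p α : ℕ) where
  open import Data.Fin using (cast)
  open import Data.Fin.Properties using (toℕ-cast; cast-involutive; combine-remQuot; toℕ-combine; toℕ<n)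
  open import Data.List using (upTo)
  open import Data.List.Membership.Propositional using (find)
  open import Data.List.Membership.Propositional.Properties using (∈-upTo⁺; ∈-upTo⁻)
  open import Data.Nat.Properties using (*-comm; *-identityʳ)

  private
    d = p ∸ 1
    P = p ^ (α ∸ 1)

  ∈-cycPP⁺ : ∀ {k j} → k < P → j < p → rootPoint p α k j ∈ verts (cycPP p α)
  ∈-cycPP⁺ {k} k<P j<p = ∈-concatMap⁺ (λ k → map (rootPoint p α k) (upTo p))
    (lose (∈-upTo⁺ k<P) (∈-map⁺ (rootPoint p α k) (∈-upTo⁺ j<p)))

  ∈-cycPP⁻ : ∀ {v} → v ∈ verts (cycPP p α) → ∃[ k ] ∃[ j ] k < P × j < p × v ≡ rootPoint p α k j
  ∈-cycPP⁻ v∈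
    with k , k∈ , v∈ₖ ← find (∈-concatMap⁻ (λ k → map (rootPoint p α k) (upTo p)) {xs = upTo P} v∈)
    with j , j∈ , refl ← ∈-map⁻ (rootPoint p α k) v∈ₖ
    = k , j , ∈-upTo⁻ k∈ , ∈-upTo⁻ j∈ , refl

  blocks↔ : Fin (d * P) ↔ Fin (P * (d * 1))
  blocks↔ = mk↔ₛ′ (cast e) (cast (sym e)) (cast-involutive e (sym e)) (cast-involutive (sym e) e)
    where e = trans (*-comm d P) (cong (P *_) (sym (*-identityʳ d)))

  rootPoint-blocks : (t : Fin P) (j : ℕ) →
                     rootPoint p α (toℕ t) j ≗ embed P t (rootPoint p 1 0 j) ∘ to blocks↔
  rootPoint-blocks t j x = begin
    rootEntry d (toℕ t) j (toℕ x)
      ≡⟨ cong (rootEntry d (toℕ t) j) x≡ ⟩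
    rootEntry d (toℕ t) j (toℕ q * d + toℕ r)
      ≡⟨ rootEntry-block (toℕ q) (toℕ t) j r<d ⟩
    (if toℕ q ≡ᵇ toℕ t then rootEntry d 0 j (toℕ r) else 0ℚ)
      ∎
    where
    open ≡-Reasoning
    q = proj₁ (remQuot {P} (d * 1) (to blocks↔ x))
    r = proj₂ (remQuot {P} (d * 1) (to blocks↔ x))
    r<d : toℕ r < d
    r<d = subst (toℕ r <_) (*-identityʳ d) (toℕ<n r)
    x≡ : toℕ x ≡ toℕ q * d + toℕ r
    x≡ = begin
      toℕ x                    ≡⟨ toℕ-cast _ x ⟨
      toℕ (to blocks↔ x)       ≡⟨ cong toℕ (combine-remQuot {P} (d * 1) (to blocks↔ x)) ⟨
      toℕ (combine q r)        ≡⟨ toℕ-combine q r ⟩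
      d * 1 * toℕ q + toℕ r    ≡⟨ cong (λ n → n * toℕ q + toℕ r) (*-identityʳ d) ⟩
      d * toℕ q + toℕ r        ≡⟨ cong (_+ toℕ r) (*-comm d (toℕ q)) ⟩
      toℕ q * d + toℕ r        ∎

cycPP≅ᵥ : (p α : ℕ) → cycPP p α ≅ᵥ directSumPow (cycPP p 1) (p ^ (α ∸ 1))
cycPP≅ᵥ p α = record { σ = blocks↔ p α ; verts-⊆ = ⊆ ; verts-⊇ = ⊇ }
  where
  open import Data.Fin using (fromℕ<)
  open import Data.Fin.Properties using (toℕ<n; toℕ-fromℕ<)
  P = p ^ (α ∸ 1)

  ⊆ : verts (directSumPow (cycPP p 1) P) ⊆[ to (blocks↔ p α) ] verts (cycPP p α)
  ⊆ u∈ with t , z , z∈ , refl ← ∈-directSumPow⁻ (cycPP p 1) P u∈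
       with 0 , j , z<s , j<p , refl ← ∈-cycPP⁻ p 1 z∈
    = rootPoint p α (toℕ t) j , ∈-cycPP⁺ p α (toℕ<n t) j<p , rootPoint-blocks p α t j

  ⊇ : verts (directSumPow (cycPP p 1) P) ⊇[ to (blocks↔ p α) ] verts (cycPP p α)
  ⊇ v∈ with k , j , k<P , j<p , refl ← ∈-cycPP⁻ p α v∈
    = embed P t (rootPoint p 1 0 j) , ∈-directSumPow⁺ (cycPP p 1) P t (∈-cycPP⁺ p 1 z<s j<p) ,
      λ x → trans (cong (λ k → rootPoint p α k j x) (sym (toℕ-fromℕ< k<P)))
                  (rootPoint-blocks p α t j x)
    where t = fromℕ< k<P

blockCount : List (ℕ × ℕ) → ℕ
blockCount []             = 1
blockCount ((p , α) ∷ fs) = p ^ (α ∸ 1) * blockCount fs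

cyc[]≅ᵥ : cyc [] ≅ᵥ directSumPow (cyc []) 1
cyc[]≅ᵥ = record
  { σ       = ↔-refl
  ; verts-⊆ = λ { (here refl) → _ , here refl , λ { Fin.zero → refl } }
  ; verts-⊇ = λ { (here refl) → _ , here refl , λ { Fin.zero → refl } }
  }

cyc≅ᵥdirectSumPow : (fs : List (ℕ × ℕ)) →
                    cyc fs ≅ᵥ directSumPow (cyc (radFactors fs)) (blockCount fs)
cyc≅ᵥdirectSumPow []             = cyc[]≅ᵥ
cyc≅ᵥdirectSumPow ((p , α) ∷ fs) =
  ≅ᵥ-trans (⊗-cong (cycPP≅ᵥ p α) (cyc≅ᵥdirectSumPow fs))
           (directSumPow-⊗ (cycPP p 1) (cyc (radFactors fs)) (p ^ (α ∸ 1)) (blockCount fs))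

value≡rad*blockCount : (fs : List (ℕ × ℕ)) → All (λ pa → 1 ≤ proj₂ pa) fs →
                       value fs ≡ value (radFactors fs) * blockCount fs
value≡rad*blockCount []                 []         = refl
value≡rad*blockCount ((p , suc α) ∷ fs) (_ ∷ 1≤αs) = begin
  p * p ^ α * value fs
    ≡⟨ cong (p * p ^ α *_) (value≡rad*blockCount fs 1≤αs) ⟩
  p * p ^ α * (value (radFactors fs) * blockCount fs)
    ≡⟨ solve 4 (λ p P V W → (p :* P) :* (V :* W) := ((p :* con 1) :* V) :* (P :* W))
             refl p (p ^ α) (value (radFactors fs)) (blockCount fs) ⟩
  p * 1 * value (radFactors fs) * (p ^ α * blockCount fs)
    ∎
  where
  open ≡-Reasoning
  open import Data.Nat.Solver using (module +-*-Solver)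
  open +-*-Solver

theorem2p5 : (m : ℕ) → 0 < m → (fs : List (ℕ × ℕ)) → IsPrimeFactorization m fs →
    (rad : ℕ) → IsPrimeFactorization rad (radFactors fs) →
    (k : ℕ) → m ≡ rad * k →
    cyc fs ≅ₚ directSumPow (cyc (radFactors fs)) k
theorem2p5 m 0<m fs (prime×1≤αs , _ , m≡value) rad (_ , _ , rad≡value) k m≡rad*k =
  subst (λ k → cyc fs ≅ₚ directSumPow (cyc (radFactors fs)) k) blockCount≡k
        (≅ᵥ⇒≅ₚ (cyc≅ᵥdirectSumPow fs))
  where
  open ≡-Reasoning
  instance
    rad≢0 : NonZero rad
    rad≢0 = m*n≢0⇒m≢0 rad {{>-nonZero (subst (0 <_) m≡rad*k 0<m)}}
  blockCount≡k : blockCount fs ≡ k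
  blockCount≡k = *-cancelˡ-≡ (blockCount fs) k rad (begin
    rad * blockCount fs                     ≡⟨ cong (_* blockCount fs) rad≡value ⟩
    value (radFactors fs) * blockCount fs   ≡⟨ value≡rad*blockCount fs (All.map proj₂ prime×1≤αs) ⟨
    value fs                                ≡⟨ m≡value ⟨
    m                                       ≡⟨ m≡rad*k ⟩
    rad * k                                 ∎)
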